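{- Let $h\ge 0$ and $0\le i\le h$ be integers. Let $\varphi_i^{(h)}(z)=\sum_{n\ge0} a_{n}z^n$, where $a_n$ is the number of Deutsch paths of length $n$ that stay within the strip $0\le y\le h$ and end at level $i$. Then, with $v=v(z)$ the power series defined below, \[ \varphi_i^{(h)}(z)=\frac{v^i(1+v+v^2)}{(1+v)^{i+1}}\cdot\frac{1-v^{h-i+2}}{1-v^{h+3}} . \]
   Context: A Deutsch path of length $n$ is a lattice path starting at $(0,0)$ consisting of $n$ steps, each of which is either an up-step $(1,1)$ or a down-step $(1,-k)$ for some integer $k\ge1$ (down-steps of arbitrary size are allowed), and which never goes below the $x$-axis. Its level after a step is its current $y$-coordinate. The empty path (length $0$) counts as a Deutsch path ending at level $0$. Let $v=v(z)=\frac{1-z-\sqrt{1-2z-3z^2}}{2z}=z+z^2+2z^3+\cdots$, the formal power series satisfying $z=\frac{v}{1+v+v^2}$; expressions in $v$ are understood as formal power series in $z$ via this substitution. -}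

module Defs where

open import Data.Nat as ℕ using (ℕ; zero; suc; _≤_; _∸_)
open import Data.Integer as ℤ using (ℤ; +_; -_; _+_; _*_; _-_)
open import Data.List using (List; []; _∷_; upTo; map; zipWith; reverse; length; foldr)
open import Data.Product using (Σ; _×_)
open import Relation.Binary.PropositionalEquality using (_≡_)

-- A step: an up-step (1,1) or a down-step (1,-(k+1)) with k : ℕ,
-- i.e. `down k` goes down by suc k ≥ 1.
data Step : Set where
  up   : Step
  down : ℕ → Step

data StripPath (h : ℕ) : ℕ → List Step → ℕ → Set where
  done : ∀ {y} → StripPath h y [] y
  stepUp : ∀ {y s e} → suc y ≤ h → StripPath h (suc y) s e →
           StripPath h y (up ∷ s) e
  stepDown : ∀ {y k s e} → suc k ≤ y → StripPath h (y ∸ suc k) s e →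
             StripPath h y (down k ∷ s) e

DeutschStrip : ℕ → ℕ → ℕ → Set
DeutschStrip h i n = Σ (List Step) (λ s → length s ≡ n × StripPath h 0 s i)

sumℤ : List ℤ → ℤ
sumℤ = foldr _+_ (+ 0)

PS : Set
PS = ℕ → ℤ

constPS : ℤ → PS
constPS c zero    = c
constPS c (suc _) = + 0

oneP : PS
oneP = constPS (+ 1)

_⊕_ : PS → PS → PS
(f ⊕ g) n = f n + g n

_⊖_ : PS → PS → PS
(f ⊖ g) n = f n - g n

_⊛_ : PS → PS → PS
(f ⊛ g) n = sumℤ (map (λ k → f k * g (n ∸ k)) (upTo (suc n)))

infixl 6 _⊕_ _⊖_
infixl 7 _⊛_

_^P_ : PS → ℕ → PS
f ^P zero    = oneP
f ^P (suc m) = f ⊛ (f ^P m)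

headOr0 : List ℤ → ℤ
headOr0 []      = + 0
headOr0 (x ∷ _) = x

-- Multiplicative inverse of a series f with f 0 = 1 (only used for such f):
-- b 0 = 1, b n = - Σ_{k=1}^{n} f k * b (n - k).
-- invRev f n = [b n, b (n-1), ..., b 0].
invRev : PS → ℕ → List ℤ
invRev f zero    = + 1 ∷ []
invRev f (suc n) =
  (- sumℤ (zipWith _*_ (map (λ k → f (suc k)) (upTo (suc n))) (invRev f n)))
  ∷ invRev f n

invP : PS → PS
invP f n = headOr0 (invRev f n)

-- The series v = z + z² + 2z³ + ⋯, the unique power series with zero
-- constant term satisfying z = v/(1+v+v²), i.e. v = z(1+v+v²).
vRev : ℕ → List ℤ
vRev zero    = + 0 ∷ []
vRev (suc n) = (constPS (+ 1) n + headOr0 (vRev n)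
                 + sumℤ (zipWith _*_ (reverse (vRev n)) (vRev n)))
               ∷ vRev n

vP : PS
vP n = headOr0 (vRev n)

rhsP : ℕ → ℕ → PS
rhsP h i =
  (vP ^P i) ⊛ (oneP ⊕ vP ⊕ vP ^P 2) ⊛ invP ((oneP ⊕ vP) ^P suc i)
  ⊛ (oneP ⊖ vP ^P ((h ∸ i) ℕ.+ 2)) ⊛ invP (oneP ⊖ vP ^P (h ℕ.+ 3))

module Submission where

-- Sorting Deutsch paths of length n+1 by their last step (an up-step from
-- level i-1, or a down-step from some level m with i < m ≤ h) gives a
-- recursion for the number of paths ending at level i; the generating
-- functions φ_i satisfy  φ_i = [i = 0] + z (φ_{i-1} + Σ_{i<m≤h} φ_m),  a
-- system that determines all coefficients.  We show that rhsP satisfies it.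

open import Defs
open import Data.Nat as ℕ using (ℕ; zero; suc; _≤_; _<_; _∸_; z≤n; s≤s)
import Data.Nat.Properties as ℕP
open import Data.Integer as ℤ using (ℤ; +_; -_; _+_; _*_; _-_)
import Data.Integer.Properties as ℤP
open import Data.Integer.Tactic.RingSolver using (solve-∀)
open import Data.List using (List; []; _∷_; _∷ʳ_; initLast; _∷ʳ′_; applyUpTo; upTo; map; zipWith; reverse; length)
import Data.List.Properties as LP
open import Data.Fin as Fin using (Fin; toℕ; fromℕ<)
import Data.Fin.Properties as FP
open import Data.Empty using (⊥)
open import Data.Sum using (_⊎_; inj₁; inj₂)
open import Data.Sum.Function.Propositional using (_⊎-↔_)
open import Function.Properties.Inverse using (↔-trans; ↔-sym)
open import Data.Product using (Σ; _×_; _,_; proj₁; proj₂)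
open import Function.Bundles using (_↔_; mk↔ₛ′)
open import Relation.Binary.PropositionalEquality
open import Relation.Nullary using (yes; no)
open import Data.Maybe using (Maybe; just; nothing)
open import Level using (0ℓ)
open import Algebra.Bundles using (CommutativeRing)
open import Algebra.Structures using (IsCommutativeRing)
open import Relation.Binary.Structures using (IsEquivalence)
open import Algebra.Solver.Ring.AlmostCommutativeRing
  using (AlmostCommutativeRing; fromCommutativeRing; _-Raw-AlmostCommutative⟶_)
import Algebra.Solver.Ring
import Relation.Binary.Reasoning.Setoid

infix 4 _≈P_

-- Equality of series is coefficientwise equality (there is no funext).
_≈P_ : PS → PS → Set
f ≈P g = ∀ n → f n ≡ g n

zeroP : PS
zeroP _ = + 0

negP : PS → PS
negP f n = - f n

scaleP : ℤ → PS → PS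
scaleP c f n = c * f n

tailP : PS → PS
tailP f n = f (suc n)

⊛-as-applyUpTo : ∀ f g n → (f ⊛ g) n ≡ sumℤ (applyUpTo (λ k → f k * g (n ∸ k)) (suc n))
⊛-as-applyUpTo f g n = cong sumℤ (LP.map-upTo (λ k → f k * g (n ∸ k)) (suc n))

⊛-head : ∀ f g → (f ⊛ g) 0 ≡ f 0 * g 0
⊛-head f g = trans (⊛-as-applyUpTo f g 0) (ℤP.+-identityʳ _)

⊛-unconsˡ : ∀ f g n → (f ⊛ g) (suc n) ≡ f 0 * g (suc n) + (tailP f ⊛ g) n
⊛-unconsˡ f g n = trans (⊛-as-applyUpTo f g (suc n))
  (cong (λ x → f 0 * g (suc n) + x) (sym (⊛-as-applyUpTo (tailP f) g n)))

⊛-unconsʳ : ∀ f g n → (f ⊛ g) (suc n) ≡ (f ⊛ tailP g) n + f (suc n) * g 0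
⊛-unconsʳ f g zero = begin
  (f ⊛ g) 1                     ≡⟨ ⊛-unconsˡ f g 0 ⟩
  f 0 * g 1 + (tailP f ⊛ g) 0   ≡⟨ cong (λ x → f 0 * g 1 + x) (⊛-head (tailP f) g) ⟩
  f 0 * g 1 + f 1 * g 0         ≡⟨ cong (_+ (f 1 * g 0)) (sym (⊛-head f (tailP g))) ⟩
  (f ⊛ tailP g) 0 + f 1 * g 0   ∎
  where open ≡-Reasoning
⊛-unconsʳ f g (suc n) = begin
  (f ⊛ g) (suc (suc n))
    ≡⟨ ⊛-unconsˡ f g (suc n) ⟩
  f 0 * g (suc (suc n)) + (tailP f ⊛ g) (suc n)
    ≡⟨ cong (λ x → f 0 * g (suc (suc n)) + x) (⊛-unconsʳ (tailP f) g n) ⟩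
  f 0 * g (suc (suc n)) + ((tailP f ⊛ tailP g) n + f (suc (suc n)) * g 0)
    ≡⟨ sym (ℤP.+-assoc (f 0 * g (suc (suc n))) _ _) ⟩
  (f 0 * g (suc (suc n)) + (tailP f ⊛ tailP g) n) + f (suc (suc n)) * g 0
    ≡⟨ cong (_+ (f (suc (suc n)) * g 0)) (sym (⊛-unconsˡ f (tailP g) n)) ⟩
  (f ⊛ tailP g) (suc n) + f (suc (suc n)) * g 0 ∎
  where open ≡-Reasoning

⊛-cong : ∀ {f f′ g g′} → f ≈P f′ → g ≈P g′ → f ⊛ g ≈P f′ ⊛ g′
⊛-cong {f} {f′} {g} {g′} p q zero =
  trans (⊛-head f g) (trans (cong₂ _*_ (p 0) (q 0)) (sym (⊛-head f′ g′)))
⊛-cong {f} {f′} {g} {g′} p q (suc n) =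
  trans (⊛-unconsˡ f g n)
    (trans (cong₂ _+_ (cong₂ _*_ (p 0) (q (suc n))) (⊛-cong (λ k → p (suc k)) q n))
           (sym (⊛-unconsˡ f′ g′ n)))

⊛-vanishˡ : ∀ f g → (∀ k → f k ≡ + 0) → ∀ n → (f ⊛ g) n ≡ + 0
⊛-vanishˡ f g p zero = trans (⊛-head f g) (trans (cong (_* g 0) (p 0)) (ℤP.*-zeroˡ (g 0)))
⊛-vanishˡ f g p (suc n) = trans (⊛-unconsˡ f g n)
  (cong₂ _+_ (trans (cong (_* g (suc n)) (p 0)) (ℤP.*-zeroˡ (g (suc n))))
             (⊛-vanishˡ (tailP f) g (λ k → p (suc k)) n))

⊛-comm : ∀ f g → f ⊛ g ≈P g ⊛ f
⊛-comm f g zero = trans (⊛-head f g) (trans (ℤP.*-comm (f 0) (g 0)) (sym (⊛-head g f)))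
⊛-comm f g (suc n) = begin
  (f ⊛ g) (suc n)                  ≡⟨ ⊛-unconsˡ f g n ⟩
  f 0 * g (suc n) + (tailP f ⊛ g) n ≡⟨ cong₂ _+_ (ℤP.*-comm (f 0) (g (suc n))) (⊛-comm (tailP f) g n) ⟩
  g (suc n) * f 0 + (g ⊛ tailP f) n ≡⟨ ℤP.+-comm (g (suc n) * f 0) _ ⟩
  (g ⊛ tailP f) n + g (suc n) * f 0 ≡⟨ sym (⊛-unconsʳ g f n) ⟩
  (g ⊛ f) (suc n)                  ∎
  where open ≡-Reasoning

⊛-distribˡ : ∀ f g k → f ⊛ (g ⊕ k) ≈P (f ⊛ g) ⊕ (f ⊛ k)
⊛-distribˡ f g k zero = trans (⊛-head f (g ⊕ k))
  (trans (ℤP.*-distribˡ-+ (f 0) (g 0) (k 0)) (sym (cong₂ _+_ (⊛-head f g) (⊛-head f k))))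
⊛-distribˡ f g k (suc n) = begin
  (f ⊛ (g ⊕ k)) (suc n)
    ≡⟨ ⊛-unconsˡ f (g ⊕ k) n ⟩
  f 0 * (g (suc n) + k (suc n)) + (tailP f ⊛ (g ⊕ k)) n
    ≡⟨ cong (λ x → f 0 * (g (suc n) + k (suc n)) + x) (⊛-distribˡ (tailP f) g k n) ⟩
  f 0 * (g (suc n) + k (suc n)) + ((tailP f ⊛ g) n + (tailP f ⊛ k) n)
    ≡⟨ rearrange (f 0) (g (suc n)) (k (suc n)) _ _ ⟩
  (f 0 * g (suc n) + (tailP f ⊛ g) n) + (f 0 * k (suc n) + (tailP f ⊛ k) n)
    ≡⟨ sym (cong₂ _+_ (⊛-unconsˡ f g n) (⊛-unconsˡ f k n)) ⟩
  ((f ⊛ g) ⊕ (f ⊛ k)) (suc n) ∎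
  where
  open ≡-Reasoning
  rearrange : ∀ a b c d e → a * (b + c) + (d + e) ≡ (a * b + d) + (a * c + e)
  rearrange = solve-∀

⊛-distribʳ : ∀ f g k → (g ⊕ k) ⊛ f ≈P (g ⊛ f) ⊕ (k ⊛ f)
⊛-distribʳ f g k n = trans (⊛-comm (g ⊕ k) f n)
  (trans (⊛-distribˡ f g k n) (cong₂ _+_ (⊛-comm f g n) (⊛-comm f k n)))

⊛-scaleˡ : ∀ c f g → scaleP c f ⊛ g ≈P scaleP c (f ⊛ g)
⊛-scaleˡ c f g zero =
  trans (⊛-head (scaleP c f) g) (trans (ℤP.*-assoc c (f 0) (g 0)) (cong (c *_) (sym (⊛-head f g))))
⊛-scaleˡ c f g (suc n) = begin
  (scaleP c f ⊛ g) (suc n)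
    ≡⟨ ⊛-unconsˡ (scaleP c f) g n ⟩
  c * f 0 * g (suc n) + (scaleP c (tailP f) ⊛ g) n
    ≡⟨ cong₂ _+_ (ℤP.*-assoc c (f 0) (g (suc n))) (⊛-scaleˡ c (tailP f) g n) ⟩
  c * (f 0 * g (suc n)) + c * (tailP f ⊛ g) n
    ≡⟨ sym (ℤP.*-distribˡ-+ c _ _) ⟩
  c * (f 0 * g (suc n) + (tailP f ⊛ g) n)
    ≡⟨ cong (c *_) (sym (⊛-unconsˡ f g n)) ⟩
  scaleP c (f ⊛ g) (suc n) ∎
  where open ≡-Reasoning

-- Associativity: peel off f 0 and recurse on the tail; the tail of a product
-- is tailP (f ⊛ g) = f 0 · tailP g + tailP f ⊛ g.
⊛-assoc : ∀ f g k → (f ⊛ g) ⊛ k ≈P f ⊛ (g ⊛ k)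
⊛-assoc f g k zero = begin
  ((f ⊛ g) ⊛ k) 0     ≡⟨ ⊛-head (f ⊛ g) k ⟩
  (f ⊛ g) 0 * k 0     ≡⟨ cong (_* k 0) (⊛-head f g) ⟩
  f 0 * g 0 * k 0     ≡⟨ ℤP.*-assoc (f 0) (g 0) (k 0) ⟩
  f 0 * (g 0 * k 0)   ≡⟨ cong (f 0 *_) (sym (⊛-head g k)) ⟩
  f 0 * (g ⊛ k) 0     ≡⟨ sym (⊛-head f (g ⊛ k)) ⟩
  (f ⊛ (g ⊛ k)) 0     ∎
  where open ≡-Reasoning
⊛-assoc f g k (suc n) = begin
  ((f ⊛ g) ⊛ k) (suc n)
    ≡⟨ ⊛-unconsˡ (f ⊛ g) k n ⟩
  (f ⊛ g) 0 * k (suc n) + (tailP (f ⊛ g) ⊛ k) n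
    ≡⟨ cong₂ _+_ (cong (_* k (suc n)) (⊛-head f g)) (⊛-cong {g = k} {g′ = k} (⊛-unconsˡ f g) (λ _ → refl) n) ⟩
  f 0 * g 0 * k (suc n) + ((scaleP (f 0) (tailP g) ⊕ (tailP f ⊛ g)) ⊛ k) n
    ≡⟨ cong (λ x → f 0 * g 0 * k (suc n) + x) (⊛-distribʳ k (scaleP (f 0) (tailP g)) (tailP f ⊛ g) n) ⟩
  f 0 * g 0 * k (suc n) + ((scaleP (f 0) (tailP g) ⊛ k) n + ((tailP f ⊛ g) ⊛ k) n)
    ≡⟨ cong (λ x → f 0 * g 0 * k (suc n) + x)
         (cong₂ _+_ (⊛-scaleˡ (f 0) (tailP g) k n) (⊛-assoc (tailP f) g k n)) ⟩
  f 0 * g 0 * k (suc n) + (f 0 * (tailP g ⊛ k) n + (tailP f ⊛ (g ⊛ k)) n)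
    ≡⟨ rearrange (f 0) (g 0) (k (suc n)) _ _ ⟩
  f 0 * (g 0 * k (suc n) + (tailP g ⊛ k) n) + (tailP f ⊛ (g ⊛ k)) n
    ≡⟨ cong (λ x → f 0 * x + (tailP f ⊛ (g ⊛ k)) n) (sym (⊛-unconsˡ g k n)) ⟩
  f 0 * (g ⊛ k) (suc n) + (tailP f ⊛ (g ⊛ k)) n
    ≡⟨ sym (⊛-unconsˡ f (g ⊛ k) n) ⟩
  (f ⊛ (g ⊛ k)) (suc n) ∎
  where
  open ≡-Reasoning
  rearrange : ∀ a b c d e → a * b * c + (a * d + e) ≡ a * (b * c + d) + e
  rearrange = solve-∀

⊛-identityˡ : ∀ f → oneP ⊛ f ≈P f
⊛-identityˡ f zero = trans (⊛-head oneP f) (ℤP.*-identityˡ (f 0))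
⊛-identityˡ f (suc n) = trans (⊛-unconsˡ oneP f n)
  (trans (cong₂ _+_ (ℤP.*-identityˡ (f (suc n))) (⊛-vanishˡ (tailP oneP) f (λ _ → refl) n))
         (ℤP.+-identityʳ _))

⊛-identityʳ : ∀ f → f ⊛ oneP ≈P f
⊛-identityʳ f n = trans (⊛-comm f oneP n) (⊛-identityˡ f n)

⊕-cong : ∀ {f f′ g g′} → f ≈P f′ → g ≈P g′ → f ⊕ g ≈P f′ ⊕ g′
⊕-cong p q n = cong₂ _+_ (p n) (q n)

⊕-identityˡ : ∀ f → zeroP ⊕ f ≈P f
⊕-identityˡ f n = ℤP.+-identityˡ (f n)

⊛-zeroˡ : ∀ f → zeroP ⊛ f ≈P zeroP
⊛-zeroˡ f = ⊛-vanishˡ zeroP f (λ _ → refl)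

^P-+ : ∀ f m n → f ^P (m ℕ.+ n) ≈P f ^P m ⊛ f ^P n
^P-+ f zero    n k = sym (⊛-identityˡ (f ^P n) k)
^P-+ f (suc m) n k = trans (⊛-cong {f} (λ _ → refl) (^P-+ f m n) k) (sym (⊛-assoc f (f ^P m) (f ^P n) k))

^P-head : ∀ f m → f 0 ≡ + 1 → (f ^P m) 0 ≡ + 1
^P-head f zero    f₀≡1 = refl
^P-head f (suc m) f₀≡1 = trans (⊛-head f (f ^P m)) (cong₂ _*_ f₀≡1 (^P-head f m f₀≡1))

≈P-isEquivalence : IsEquivalence _≈P_
≈P-isEquivalence = record
  { refl = λ _ → refl ; sym = λ p n → sym (p n) ; trans = λ p q n → trans (p n) (q n) }

PS-isCommutativeRing : IsCommutativeRing _≈P_ _⊕_ _⊛_ negP zeroP oneP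
PS-isCommutativeRing = record
  { isRing = record
    { +-isAbelianGroup = record
      { isGroup = record
        { isMonoid = record
          { isSemigroup = record
            { isMagma = record
              { isEquivalence = ≈P-isEquivalence ; ∙-cong = ⊕-cong }
            ; assoc = λ f g k n → ℤP.+-assoc (f n) (g n) (k n) }
          ; identity = ⊕-identityˡ , (λ f n → ℤP.+-identityʳ (f n)) }
        ; inverse = (λ f n → ℤP.+-inverseˡ (f n)) , (λ f n → ℤP.+-inverseʳ (f n))
        ; ⁻¹-cong = λ p n → cong -_ (p n) }
      ; comm = λ f g n → ℤP.+-comm (f n) (g n) }
    ; *-cong = ⊛-cong
    ; *-assoc = ⊛-assoc
    ; *-identity = ⊛-identityˡ , ⊛-identityʳ
    ; distrib = ⊛-distribˡ , ⊛-distribʳ }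
  ; *-comm = ⊛-comm }

PS-commutativeRing : CommutativeRing 0ℓ 0ℓ
PS-commutativeRing = record { isCommutativeRing = PS-isCommutativeRing }

-- Integer constants embed as constant series; this makes PS a ring over ℤ,
-- which is what the ring solver needs.
constPS-homo-* : ∀ x y → constPS (x * y) ≈P constPS x ⊛ constPS y
constPS-homo-* x y zero = sym (⊛-head (constPS x) (constPS y))
constPS-homo-* x y (suc n) = sym (trans (⊛-unconsˡ (constPS x) (constPS y) n)
  (cong₂ _+_ (ℤP.*-zeroʳ x) (⊛-vanishˡ (tailP (constPS x)) (constPS y) (λ _ → refl) n)))

PS-almostCommutativeRing : AlmostCommutativeRing 0ℓ 0ℓ
PS-almostCommutativeRing = fromCommutativeRing PS-commutativeRing

constPS-morphism : ℤ.+-*-rawRing -Raw-AlmostCommutative⟶ PS-almostCommutativeRing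
constPS-morphism = record
  { ⟦_⟧ = constPS
  ; +-homo = λ x y → λ { zero → refl ; (suc n) → refl }
  ; *-homo = constPS-homo-*
  ; -‿homo = λ x → λ { zero → refl ; (suc n) → refl }
  ; 0-homo = λ { zero → refl ; (suc n) → refl }
  ; 1-homo = λ n → refl }

constPS-≟ : ∀ a b → Maybe (constPS a ≈P constPS b)
constPS-≟ a b with a ℤ.≟ b
... | yes refl = just (λ _ → refl)
... | no _ = nothing

module PS-Solver = Algebra.Solver.Ring ℤ.+-*-rawRing PS-almostCommutativeRing constPS-morphism constPS-≟
module PS-Reasoning = Relation.Binary.Reasoning.Setoid (CommutativeRing.setoid PS-commutativeRing)

open PS-Solver using (solve; _:=_; _:+_; _:-_; _:*_; con)

zipWith-applyUpTo : ∀ {A B C : Set} (_∙_ : A → B → C) (F : ℕ → A) (G : ℕ → B) m →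
  zipWith _∙_ (applyUpTo F m) (applyUpTo G m) ≡ applyUpTo (λ k → F k ∙ G k) m
zipWith-applyUpTo _∙_ F G zero = refl
zipWith-applyUpTo _∙_ F G (suc m) =
  cong (F 0 ∙ G 0 ∷_) (zipWith-applyUpTo _∙_ (λ k → F (suc k)) (λ k → G (suc k)) m)

invRev-spec : ∀ f n → invRev f n ≡ applyUpTo (λ k → invP f (n ∸ k)) (suc n)
invRev-spec f zero = refl
invRev-spec f (suc n) = cong (invP f (suc n) ∷_) (invRev-spec f n)

invP-suc : ∀ f n → invP f (suc n) ≡ - (tailP f ⊛ invP f) n
invP-suc f n = cong -_ (begin
  sumℤ (zipWith _*_ (map (λ k → f (suc k)) (upTo (suc n))) (invRev f n))
    ≡⟨ cong₂ (λ xs ys → sumℤ (zipWith _*_ xs ys)) (LP.map-upTo (λ k → f (suc k)) (suc n)) (invRev-spec f n) ⟩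
  sumℤ (zipWith _*_ (applyUpTo (λ k → f (suc k)) (suc n)) (applyUpTo (λ k → invP f (n ∸ k)) (suc n)))
    ≡⟨ cong sumℤ (zipWith-applyUpTo _*_ (λ k → f (suc k)) (λ k → invP f (n ∸ k)) (suc n)) ⟩
  sumℤ (applyUpTo (λ k → f (suc k) * invP f (n ∸ k)) (suc n))
    ≡⟨ sym (⊛-as-applyUpTo (tailP f) (invP f) n) ⟩
  (tailP f ⊛ invP f) n ∎)
  where open ≡-Reasoning

invP-inverse : ∀ f → f 0 ≡ + 1 → f ⊛ invP f ≈P oneP
invP-inverse f f₀≡1 zero = trans (⊛-head f (invP f)) (cong (_* + 1) f₀≡1)
invP-inverse f f₀≡1 (suc n) = begin
  (f ⊛ invP f) (suc n)
    ≡⟨ ⊛-unconsˡ f (invP f) n ⟩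
  f 0 * invP f (suc n) + (tailP f ⊛ invP f) n
    ≡⟨ cong₂ (λ a b → a * b + (tailP f ⊛ invP f) n) f₀≡1 (invP-suc f n) ⟩
  + 1 * - (tailP f ⊛ invP f) n + (tailP f ⊛ invP f) n
    ≡⟨ cong (_+ (tailP f ⊛ invP f) n) (ℤP.*-identityˡ (- (tailP f ⊛ invP f) n)) ⟩
  - (tailP f ⊛ invP f) n + (tailP f ⊛ invP f) n
    ≡⟨ ℤP.+-inverseˡ ((tailP f ⊛ invP f) n) ⟩
  + 0 ∎
  where open ≡-Reasoning

vRev-spec : ∀ n → vRev n ≡ applyUpTo (λ k → vP (n ∸ k)) (suc n)
vRev-spec zero = refl
vRev-spec (suc n) = cong (vP (suc n) ∷_) (vRev-spec n)

reverse-vRev : ∀ n → reverse (vRev n) ≡ applyUpTo vP (suc n)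
reverse-vRev zero = refl
reverse-vRev (suc n) = begin
  reverse (vP (suc n) ∷ vRev n)       ≡⟨ LP.unfold-reverse (vP (suc n)) (vRev n) ⟩
  reverse (vRev n) ∷ʳ vP (suc n)      ≡⟨ cong (_∷ʳ vP (suc n)) (reverse-vRev n) ⟩
  applyUpTo vP (suc n) ∷ʳ vP (suc n)  ≡⟨ LP.applyUpTo-∷ʳ vP (suc n) ⟩
  applyUpTo vP (suc (suc n))          ∎
  where open ≡-Reasoning

vP-suc : ∀ n → vP (suc n) ≡ oneP n + vP n + (vP ⊛ vP) n
vP-suc n = cong (λ x → oneP n + vP n + x) (begin
  sumℤ (zipWith _*_ (reverse (vRev n)) (vRev n))
    ≡⟨ cong₂ (λ xs ys → sumℤ (zipWith _*_ xs ys)) (reverse-vRev n) (vRev-spec n) ⟩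
  sumℤ (zipWith _*_ (applyUpTo vP (suc n)) (applyUpTo (λ k → vP (n ∸ k)) (suc n)))
    ≡⟨ cong sumℤ (zipWith-applyUpTo _*_ vP (λ k → vP (n ∸ k)) (suc n)) ⟩
  sumℤ (applyUpTo (λ k → vP k * vP (n ∸ k)) (suc n))
    ≡⟨ sym (⊛-as-applyUpTo vP vP n) ⟩
  (vP ⊛ vP) n ∎)
  where open ≡-Reasoning

zP : PS
zP zero    = + 0
zP (suc k) = oneP k

z⊛-head : ∀ f → (zP ⊛ f) 0 ≡ + 0
z⊛-head f = trans (⊛-head zP f) (ℤP.*-zeroˡ (f 0))

z⊛-suc : ∀ f n → (zP ⊛ f) (suc n) ≡ f n
z⊛-suc f n = begin
  (zP ⊛ f) (suc n)                ≡⟨ ⊛-unconsˡ zP f n ⟩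
  + 0 * f (suc n) + (oneP ⊛ f) n  ≡⟨ cong₂ _+_ (ℤP.*-zeroˡ (f (suc n))) (⊛-identityˡ f n) ⟩
  + 0 + f n                       ≡⟨ ℤP.+-identityˡ (f n) ⟩
  f n                             ∎
  where open ≡-Reasoning

bP : PS
bP = oneP ⊕ vP

qP : PS
qP = oneP ⊕ vP ⊕ vP ^P 2

z⊛q≈v : zP ⊛ qP ≈P vP
z⊛q≈v zero = z⊛-head qP
z⊛q≈v (suc n) = begin
  (zP ⊛ qP) (suc n)                       ≡⟨ z⊛-suc qP n ⟩
  oneP n + vP n + (vP ⊛ (vP ⊛ oneP)) n    ≡⟨ cong (λ x → oneP n + vP n + x) (⊛-cong {vP} (λ _ → refl) (⊛-identityʳ vP) n) ⟩
  oneP n + vP n + (vP ⊛ vP) n             ≡⟨ sym (vP-suc n) ⟩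
  vP (suc n)                              ∎
  where open ≡-Reasoning

sumP : (ℕ → PS) → ℕ → PS
sumP F zero    = zeroP
sumP F (suc k) = F 0 ⊕ sumP (λ t → F (suc t)) k

sumP-cong : ∀ {F G} k → (∀ t → F t ≈P G t) → sumP F k ≈P sumP G k
sumP-cong zero    p = λ _ → refl
sumP-cong (suc k) p = ⊕-cong (p 0) (sumP-cong k (λ t → p (suc t)))

oneMinusV^ : ℕ → PS
oneMinusV^ m = oneP ⊖ vP ^P m

-- The common denominator (1+v)^{h+1} (1 - v^{h+3}) of the series rhsP h j.
denom : ℕ → PS
denom h = bP ^P suc h ⊛ oneMinusV^ (h ℕ.+ 3)

denom⁻¹ : ℕ → PS
denom⁻¹ h = invP (bP ^P suc h) ⊛ invP (oneMinusV^ (h ℕ.+ 3))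

-- The numerator: rhsP h j · denom h = q · numer h j (see rhsP-clear).
numer : ℕ → ℕ → PS
numer h j = (vP ^P j ⊖ vP ^P suc (suc h)) ⊛ bP ^P (h ∸ j)

-- v has no constant term, so 1 - v^{h+3} has constant term 1.
oneMinusV^-head : ∀ h → oneMinusV^ (h ℕ.+ 3) 0 ≡ + 1
oneMinusV^-head h = cong (λ m → oneMinusV^ m 0) (ℕP.+-comm h 3)

denom-inverse : ∀ h → denom h ⊛ denom⁻¹ h ≈P oneP
denom-inverse h = begin
  (B ⊛ D) ⊛ (invP B ⊛ invP D)
    ≈⟨ solve 4 (λ b d b′ d′ → (b :* d) :* (b′ :* d′) := (b :* b′) :* (d :* d′)) (λ _ → refl)
         B D (invP B) (invP D) ⟩
  (B ⊛ invP B) ⊛ (D ⊛ invP D)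
    ≈⟨ ⊛-cong (invP-inverse B (^P-head bP (suc h) refl)) (invP-inverse D (oneMinusV^-head h)) ⟩
  oneP ⊛ oneP
    ≈⟨ ⊛-identityˡ oneP ⟩
  oneP ∎
  where
  open PS-Reasoning
  B = bP ^P suc h
  D = oneMinusV^ (h ℕ.+ 3)

numer-as-product : ∀ h j → j ≤ h →
  (vP ^P j ⊛ oneMinusV^ ((h ∸ j) ℕ.+ 2)) ⊛ bP ^P (h ∸ j) ≈P numer h j
numer-as-product h j j≤h = begin
  (vP ^P j ⊛ oneMinusV^ (k ℕ.+ 2)) ⊛ bP ^P k
    ≈⟨ solve 3 (λ A P B → (A :* (con (+ 1) :- P)) :* B := (A :- A :* P) :* B) (λ _ → refl)
         (vP ^P j) (vP ^P (k ℕ.+ 2)) (bP ^P k) ⟩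
  (vP ^P j ⊖ vP ^P j ⊛ vP ^P (k ℕ.+ 2)) ⊛ bP ^P k
    ≈⟨ ⊛-cong {g = bP ^P k} (λ n → cong (λ x → (vP ^P j) n - x) (sym (^P-+ vP j (k ℕ.+ 2) n))) (λ _ → refl) ⟩
  (vP ^P j ⊖ vP ^P (j ℕ.+ (k ℕ.+ 2))) ⊛ bP ^P k
    ≡⟨ cong (λ m → (vP ^P j ⊖ vP ^P m) ⊛ bP ^P k) exponent ⟩
  numer h j ∎
  where
  open PS-Reasoning
  k = h ∸ j
  exponent : j ℕ.+ (k ℕ.+ 2) ≡ suc (suc h)
  exponent = trans (sym (ℕP.+-assoc j k 2))
    (trans (ℕP.+-comm (j ℕ.+ k) 2) (cong (2 ℕ.+_) (ℕP.m+[n∸m]≡n j≤h)))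

rhsP-clear : ∀ h j → j ≤ h → rhsP h j ⊛ denom h ≈P qP ⊛ numer h j
rhsP-clear h j j≤h = begin
  rhsP h j ⊛ (bP ^P suc h ⊛ D)
    ≈⟨ ⊛-cong {rhsP h j} (λ _ → refl) (⊛-cong {g = D} b-split (λ _ → refl)) ⟩
  rhsP h j ⊛ ((Bj ⊛ Bk) ⊛ D)
    ≈⟨ solve 8 (λ Vj q Bj′ N D′ Bj Bk D → ((((Vj :* q) :* Bj′) :* N) :* D′) :* ((Bj :* Bk) :* D)
                   := ((q :* ((Vj :* N) :* Bk)) :* (Bj :* Bj′)) :* (D :* D′)) (λ _ → refl)
         (vP ^P j) qP (invP Bj) N (invP D) Bj Bk D ⟩
  ((qP ⊛ P) ⊛ (Bj ⊛ invP Bj)) ⊛ (D ⊛ invP D)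
    ≈⟨ ⊛-cong (⊛-cong {qP ⊛ P} (λ _ → refl) (invP-inverse Bj (^P-head bP (suc j) refl)))
              (invP-inverse D (oneMinusV^-head h)) ⟩
  ((qP ⊛ P) ⊛ oneP) ⊛ oneP
    ≈⟨ ⊛-identityʳ _ ⟩
  (qP ⊛ P) ⊛ oneP
    ≈⟨ ⊛-identityʳ _ ⟩
  qP ⊛ P
    ≈⟨ ⊛-cong {qP} (λ _ → refl) (numer-as-product h j j≤h) ⟩
  qP ⊛ numer h j ∎
  where
  open PS-Reasoning
  Bj = bP ^P suc j
  Bk = bP ^P (h ∸ j)
  D = oneMinusV^ (h ℕ.+ 3)
  N = oneMinusV^ ((h ∸ j) ℕ.+ 2)
  P = (vP ^P j ⊛ N) ⊛ Bk
  b-split : bP ^P suc h ≈P Bj ⊛ Bk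
  b-split n = trans (cong (λ m → (bP ^P suc m) n) (sym (ℕP.m+[n∸m]≡n j≤h))) (^P-+ bP (suc j) (h ∸ j) n)

numer-at : ∀ j k {h} → j ℕ.+ k ≡ h → numer h j ≡ (vP ^P j ⊖ vP ^P suc (suc h)) ⊛ bP ^P k
numer-at j k refl = cong (λ m → (vP ^P j ⊖ vP ^P suc (suc (j ℕ.+ k))) ⊛ bP ^P m) (ℕP.m+n∸m≡n j k)

-- The sum of numerators over a final segment of levels telescopes:
-- v Σ_{t<m} numer h (i+t) = v (1+v)^m (v^i - v^{h+1})   when i + m = h + 1.
telescope : ∀ m i h → i ℕ.+ m ≡ suc h →
  vP ⊛ sumP (λ t → numer h (i ℕ.+ t)) m ≈P (vP ⊛ bP ^P m) ⊛ (vP ^P i ⊖ vP ^P suc h)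
telescope zero i h i≡h+1 with refl ← trans (sym (ℕP.+-identityʳ i)) i≡h+1 = λ n →
  trans (⊛-comm vP zeroP n)
    (trans (⊛-zeroˡ vP n)
      (sym (trans (⊛-comm (vP ⊛ oneP) (Q ⊖ Q) n)
                  (⊛-vanishˡ (Q ⊖ Q) (vP ⊛ oneP) (λ k → ℤP.+-inverseʳ (Q k)) n))))
  where Q = vP ^P suc h
telescope (suc m) i h i+m+1≡h+1 with refl ← ℕP.suc-injective (trans (sym (ℕP.+-suc i m)) i+m+1≡h+1) = begin
  vP ⊛ (numer h (i ℕ.+ 0) ⊕ sumP (λ t → numer h (i ℕ.+ suc t)) m)
    ≈⟨ ⊛-cong {vP} (λ _ → refl)
         (⊕-cong (cong-app (cong (numer h) (ℕP.+-identityʳ i)))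
                 (sumP-cong m (λ t → cong-app (cong (numer h) (ℕP.+-suc i t))))) ⟩
  vP ⊛ (numer h i ⊕ sumP (λ t → numer h (suc i ℕ.+ t)) m)
    ≈⟨ ⊛-distribˡ vP (numer h i) (sumP (λ t → numer h (suc i ℕ.+ t)) m) ⟩
  vP ⊛ numer h i ⊕ vP ⊛ sumP (λ t → numer h (suc i ℕ.+ t)) m
    ≈⟨ ⊕-cong (⊛-cong {vP} (λ _ → refl) (cong-app (numer-at i m refl))) (telescope m (suc i) h refl) ⟩
  vP ⊛ ((A ⊖ vP ⊛ Q) ⊛ B) ⊕ (vP ⊛ B) ⊛ (vP ⊛ A ⊖ Q)
    ≈⟨ solve 4 (λ V A Q B → V :* ((A :- V :* Q) :* B) :+ (V :* B) :* (V :* A :- Q)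
                             := (V :* ((con (+ 1) :+ V) :* B)) :* (A :- Q)) (λ _ → refl) vP A Q B ⟩
  (vP ⊛ bP ^P suc m) ⊛ (A ⊖ Q) ∎
  where
  open PS-Reasoning
  A = vP ^P i
  Q = vP ^P suc h
  B = bP ^P m

δP : ℕ → PS
δP zero    = oneP
δP (suc _) = zeroP

-- For a family F of series indexed by levels: the contribution of the level
-- below i (the source of an up-step into i), and of the levels i < m ≤ h
-- (the sources of a down-step into i).
belowP : (ℕ → PS) → ℕ → PS
belowP F zero    = zeroP
belowP F (suc i) = F i

aboveP : ℕ → (ℕ → PS) → ℕ → PS
aboveP h F i = sumP (λ t → F (suc i ℕ.+ t)) (h ∸ i)

stepP : ℕ → (ℕ → PS) → ℕ → PS
stepP h F i = belowP F i ⊕ aboveP h F i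

above-bound : ∀ {h i t} → i ≤ h → t < h ∸ i → suc i ℕ.+ t ≤ h
above-bound {h} {i} {t} i≤h t<h-i = begin
  suc i ℕ.+ t      ≡⟨ sym (ℕP.+-suc i t) ⟩
  i ℕ.+ suc t      ≤⟨ ℕP.+-monoʳ-≤ i t<h-i ⟩
  i ℕ.+ (h ∸ i)    ≡⟨ ℕP.m+[n∸m]≡n i≤h ⟩
  h                ∎
  where open ℕP.≤-Reasoning

numer-identity : ∀ h i → i ≤ h → qP ⊛ numer h i ≈P δP i ⊛ denom h ⊕ vP ⊛ stepP h (numer h) i
numer-identity h zero _ = begin
  qP ⊛ ((oneP ⊖ vP ⊛ Q) ⊛ B)
    ≈⟨ solve 3 (λ V Q B → ((con (+ 1) :+ V) :+ V :* (V :* con (+ 1))) :* ((con (+ 1) :- V :* Q) :* B)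
                 := ((con (+ 1) :+ V) :* B) :* (con (+ 1) :- V :* (V :* Q)) :+ (V :* B) :* (V :* con (+ 1) :- Q))
         (λ _ → refl) vP Q B ⟩
  bP ^P suc h ⊛ oneMinusV^ (3 ℕ.+ h) ⊕ (vP ⊛ B) ⊛ (vP ^P 1 ⊖ Q)
    ≡⟨ cong (λ m → bP ^P suc h ⊛ oneMinusV^ m ⊕ (vP ⊛ B) ⊛ (vP ^P 1 ⊖ Q)) (ℕP.+-comm 3 h) ⟩
  denom h ⊕ (vP ⊛ B) ⊛ (vP ^P 1 ⊖ Q)
    ≈⟨ ⊕-cong (λ n → sym (⊛-identityˡ (denom h) n)) (λ n → sym (telescope h 1 h refl n)) ⟩
  oneP ⊛ denom h ⊕ vP ⊛ aboveP h (numer h) 0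
    ≈⟨ ⊕-cong {oneP ⊛ denom h} (λ _ → refl) (⊛-cong {vP} (λ _ → refl) (λ n → sym (⊕-identityˡ (aboveP h (numer h) 0) n))) ⟩
  oneP ⊛ denom h ⊕ vP ⊛ stepP h (numer h) 0 ∎
  where
  open PS-Reasoning
  Q = vP ^P suc h
  B = bP ^P h
numer-identity h (suc j) j<h = begin
  qP ⊛ ((vP ⊛ W ⊖ vP ⊛ Q) ⊛ B)
    ≈⟨ solve 4 (λ V W Q B → ((con (+ 1) :+ V) :+ V :* (V :* con (+ 1))) :* ((V :* W :- V :* Q) :* B)
                 := V :* ((W :- V :* Q) :* ((con (+ 1) :+ V) :* B)) :+ (V :* B) :* (V :* (V :* W) :- Q))
         (λ _ → refl) vP W Q B ⟩
  vP ⊛ ((W ⊖ vP ⊛ Q) ⊛ bP ^P suc k) ⊕ (vP ⊛ B) ⊛ (vP ^P suc (suc j) ⊖ Q)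
    ≈⟨ ⊕-cong (⊛-cong {vP} (λ _ → refl) (cong-app (sym (numer-at j (suc k) j+k+1≡h))))
              (λ n → sym (telescope k (suc (suc j)) h (cong suc (ℕP.m+[n∸m]≡n j<h)) n)) ⟩
  vP ⊛ numer h j ⊕ vP ⊛ aboveP h (numer h) (suc j)
    ≈⟨ (λ n → sym (⊛-distribˡ vP (numer h j) (aboveP h (numer h) (suc j)) n)) ⟩
  vP ⊛ stepP h (numer h) (suc j)
    ≈⟨ (λ n → sym (⊕-identityˡ (vP ⊛ stepP h (numer h) (suc j)) n)) ⟩
  zeroP ⊕ vP ⊛ stepP h (numer h) (suc j)
    ≈⟨ ⊕-cong (λ n → sym (⊛-zeroˡ (denom h) n)) (λ _ → refl) ⟩
  zeroP ⊛ denom h ⊕ vP ⊛ stepP h (numer h) (suc j) ∎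
  where
  open PS-Reasoning
  k = h ∸ suc j
  W = vP ^P j
  Q = vP ^P suc h
  B = bP ^P k
  j+k+1≡h : j ℕ.+ suc k ≡ h
  j+k+1≡h = trans (ℕP.+-suc j k) (ℕP.m+[n∸m]≡n j<h)

zeroP-transfer : ∀ e c → zeroP ⊛ e ≈P c ⊛ zeroP
zeroP-transfer e c n = trans (⊛-zeroˡ e n) (sym (trans (⊛-comm c zeroP n) (⊛-zeroˡ c n)))

sumP-transfer : ∀ {e c F G} k → (∀ t → t < k → F t ⊛ e ≈P c ⊛ G t) →
  sumP F k ⊛ e ≈P c ⊛ sumP G k
sumP-transfer {e} {c} zero    _ = zeroP-transfer e c
sumP-transfer {e} {c} {F} {G} (suc k) p = begin
  (F 0 ⊕ sumP (λ t → F (suc t)) k) ⊛ e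
    ≈⟨ ⊛-distribʳ e (F 0) (sumP (λ t → F (suc t)) k) ⟩
  F 0 ⊛ e ⊕ sumP (λ t → F (suc t)) k ⊛ e
    ≈⟨ ⊕-cong (p 0 (s≤s z≤n)) (sumP-transfer {e} {c} {λ t → F (suc t)} {λ t → G (suc t)} k (λ t t<k → p (suc t) (s≤s t<k))) ⟩
  c ⊛ G 0 ⊕ c ⊛ sumP (λ t → G (suc t)) k
    ≈⟨ (λ n → sym (⊛-distribˡ c (G 0) (sumP (λ t → G (suc t)) k) n)) ⟩
  c ⊛ (G 0 ⊕ sumP (λ t → G (suc t)) k) ∎
  where open PS-Reasoning

stepP-transfer : ∀ {e c F G} h i → i ≤ h → (∀ j → j ≤ h → F j ⊛ e ≈P c ⊛ G j) →
  stepP h F i ⊛ e ≈P c ⊛ stepP h G i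
stepP-transfer {e} {c} {F} {G} h i i≤h p = begin
  (belowP F i ⊕ aboveP h F i) ⊛ e
    ≈⟨ ⊛-distribʳ e (belowP F i) (aboveP h F i) ⟩
  belowP F i ⊛ e ⊕ aboveP h F i ⊛ e
    ≈⟨ ⊕-cong (below i i≤h) (sumP-transfer {e} {c} {λ t → F (suc i ℕ.+ t)} {λ t → G (suc i ℕ.+ t)} (h ∸ i)
                (λ t t<h-i → p (suc i ℕ.+ t) (above-bound i≤h t<h-i))) ⟩
  c ⊛ belowP G i ⊕ c ⊛ aboveP h G i
    ≈⟨ (λ n → sym (⊛-distribˡ c (belowP G i) (aboveP h G i) n)) ⟩
  c ⊛ (belowP G i ⊕ aboveP h G i) ∎
  where
  open PS-Reasoning
  below : ∀ i → i ≤ h → belowP F i ⊛ e ≈P c ⊛ belowP G i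
  below zero    _   = zeroP-transfer e c
  below (suc j) j<h = p j (ℕP.<⇒≤ j<h)

⊛-cancelʳ : ∀ {e e′ f g} → e ⊛ e′ ≈P oneP → f ⊛ e ≈P g ⊛ e → f ≈P g
⊛-cancelʳ {e} {e′} {f} {g} ee′≈1 fe≈ge = begin
  f                  ≈⟨ (λ n → sym (⊛-identityʳ f n)) ⟩
  f ⊛ oneP           ≈⟨ ⊛-cong {f} (λ _ → refl) (λ n → sym (ee′≈1 n)) ⟩
  f ⊛ (e ⊛ e′)       ≈⟨ (λ n → sym (⊛-assoc f e e′ n)) ⟩
  (f ⊛ e) ⊛ e′       ≈⟨ ⊛-cong {g = e′} fe≈ge (λ _ → refl) ⟩
  (g ⊛ e) ⊛ e′       ≈⟨ ⊛-assoc g e e′ ⟩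
  g ⊛ (e ⊛ e′)       ≈⟨ ⊛-cong {g} (λ _ → refl) ee′≈1 ⟩
  g ⊛ oneP           ≈⟨ ⊛-identityʳ g ⟩
  g                  ∎
  where open PS-Reasoning

-- The functional equation φ_i = [i = 0] + z (φ_{i-1} + Σ_{i<m≤h} φ_m) for
-- φ_i = rhsP h i: multiply by the common denominator, which turns it into
-- numer-identity, and cancel.
functionalEquation : ∀ h i → i ≤ h → rhsP h i ≈P δP i ⊕ zP ⊛ stepP h (rhsP h) i
functionalEquation h i i≤h = ⊛-cancelʳ (denom-inverse h) (begin
  rhsP h i ⊛ denom h
    ≈⟨ rhsP-clear h i i≤h ⟩
  qP ⊛ numer h i
    ≈⟨ numer-identity h i i≤h ⟩
  δP i ⊛ denom h ⊕ vP ⊛ stepP h (numer h) i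
    ≈⟨ ⊕-cong {δP i ⊛ denom h} (λ _ → refl) (⊛-cong {g = stepP h (numer h) i} (λ n → sym (z⊛q≈v n)) (λ _ → refl)) ⟩
  δP i ⊛ denom h ⊕ (zP ⊛ qP) ⊛ stepP h (numer h) i
    ≈⟨ ⊕-cong {δP i ⊛ denom h} (λ _ → refl)
         (λ n → trans (⊛-assoc zP qP (stepP h (numer h) i) n)
                      (sym (⊛-cong {zP} (λ _ → refl) (stepP-transfer {denom h} {qP} {rhsP h} {numer h} h i i≤h (rhsP-clear h)) n))) ⟩
  δP i ⊛ denom h ⊕ zP ⊛ (stepP h (rhsP h) i ⊛ denom h)
    ≈⟨ solve 4 (λ d e z s → d :* e :+ z :* (s :* e) := (d :+ z :* s) :* e) (λ _ → refl)
         (δP i) (denom h) zP (stepP h (rhsP h) i) ⟩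
  (δP i ⊕ zP ⊛ stepP h (rhsP h) i) ⊛ denom h ∎)
  where open PS-Reasoning

sumN : (ℕ → ℕ) → ℕ → ℕ
sumN c zero    = 0
sumN c (suc k) = c 0 ℕ.+ sumN (λ t → c (suc t)) k

belowN : (ℕ → ℕ) → ℕ → ℕ
belowN c zero    = 0
belowN c (suc i) = c i

stepN : ℕ → (ℕ → ℕ) → ℕ → ℕ
stepN h c i = belowN c i ℕ.+ sumN (λ t → c (suc i ℕ.+ t)) (h ∸ i)

-- count h n i is defined by the last-step recursion; by countIso below it is
-- the number of Deutsch paths of length n in the strip ending at level i.
count : ℕ → ℕ → ℕ → ℕ
count h zero    zero    = 1
count h zero    (suc i) = 0
count h (suc n) i       = stepN h (count h n) i

sumP-coeff : ∀ {F c} k n → (∀ t → t < k → F t n ≡ + c t) → sumP F k n ≡ + sumN c k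
sumP-coeff zero    n _ = refl
sumP-coeff {F} {c} (suc k) n p = begin
  F 0 n + sumP (λ t → F (suc t)) k n
    ≡⟨ cong₂ _+_ (p 0 (s≤s z≤n)) (sumP-coeff {λ t → F (suc t)} {λ t → c (suc t)} k n (λ t t<k → p (suc t) (s≤s t<k))) ⟩
  + c 0 + + sumN (λ t → c (suc t)) k
    ≡⟨ sym (ℤP.pos-+ (c 0) (sumN (λ t → c (suc t)) k)) ⟩
  + sumN c (suc k) ∎
  where open ≡-Reasoning

stepP-coeff : ∀ {F c} h i n → i ≤ h → (∀ j → j ≤ h → F j n ≡ + c j) → stepP h F i n ≡ + stepN h c i
stepP-coeff {F} {c} h i n i≤h p = begin
  belowP F i n + aboveP h F i n
    ≡⟨ cong₂ _+_ (below i i≤h)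
         (sumP-coeff {λ t → F (suc i ℕ.+ t)} {λ t → c (suc i ℕ.+ t)} (h ∸ i) n
           (λ t t<h-i → p (suc i ℕ.+ t) (above-bound i≤h t<h-i))) ⟩
  + belowN c i + + sumN (λ t → c (suc i ℕ.+ t)) (h ∸ i)
    ≡⟨ sym (ℤP.pos-+ (belowN c i) _) ⟩
  + stepN h c i ∎
  where
  open ≡-Reasoning
  below : ∀ i → i ≤ h → belowP F i n ≡ + belowN c i
  below zero    _   = refl
  below (suc j) j<h = p j (ℕP.<⇒≤ j<h)

δP-suc : ∀ i n → δP i (suc n) ≡ + 0
δP-suc zero    n = refl
δP-suc (suc i) n = refl

-- Reading off coefficients of the functional equation.
rhsP-coeff : ∀ h n i → i ≤ h → rhsP h i n ≡ + count h n i
rhsP-coeff h zero i i≤h =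
  trans (functionalEquation h i i≤h 0) (trans (cong (λ x → δP i 0 + x) (z⊛-head (stepP h (rhsP h) i))) (initial i))
  where
  initial : ∀ i → δP i 0 + + 0 ≡ + count h 0 i
  initial zero    = refl
  initial (suc i) = refl
rhsP-coeff h (suc n) i i≤h = begin
  rhsP h i (suc n)
    ≡⟨ functionalEquation h i i≤h (suc n) ⟩
  δP i (suc n) + (zP ⊛ stepP h (rhsP h) i) (suc n)
    ≡⟨ cong₂ _+_ (δP-suc i n) (z⊛-suc (stepP h (rhsP h) i) n) ⟩
  + 0 + stepP h (rhsP h) i n
    ≡⟨ ℤP.+-identityˡ (stepP h (rhsP h) i n) ⟩
  stepP h (rhsP h) i n
    ≡⟨ stepP-coeff h i n i≤h (λ j j≤h → rhsP-coeff h n j j≤h) ⟩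
  + count h (suc n) i ∎
  where open ≡-Reasoning

stripPath-irrelevant : ∀ {h y s e} (p q : StripPath h y s e) → p ≡ q
stripPath-irrelevant done           done           = refl
stripPath-irrelevant (stepUp a p)   (stepUp b q)   = cong₂ stepUp (ℕP.≤-irrelevant a b) (stripPath-irrelevant p q)
stripPath-irrelevant (stepDown a p) (stepDown b q) = cong₂ stepDown (ℕP.≤-irrelevant a b) (stripPath-irrelevant p q)

deutschStrip-≡ : ∀ {h e n} (w w′ : DeutschStrip h e n) → proj₁ w ≡ proj₁ w′ → w ≡ w′
deutschStrip-≡ (s , len , p) (.s , len′ , p′) refl =
  cong₂ (λ l q → s , l , q) (ℕP.≡-irrelevant len len′) (stripPath-irrelevant p p′)

stripPath-bound : ∀ {h y s e} → StripPath h y s e → y ≤ h → e ≤ h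
stripPath-bound done y≤h = y≤h
stripPath-bound (stepUp y+1≤h p) _ = stripPath-bound p y+1≤h
stripPath-bound (stepDown {y = y} {k = k} _ p) y≤h = stripPath-bound p (ℕP.≤-trans (ℕP.m∸n≤m y (suc k)) y≤h)

stripPath-unsnoc : ∀ {h y e} s x → StripPath h y (s ∷ʳ x) e →
  Σ ℕ (λ m → StripPath h y s m × StripPath h m (x ∷ []) e)
stripPath-unsnoc []           x p = _ , done , p
stripPath-unsnoc (up ∷ s)     x (stepUp a p) with stripPath-unsnoc s x p
... | m , p₁ , p₂ = m , stepUp a p₁ , p₂
stripPath-unsnoc (down k ∷ s) x (stepDown a p) with stripPath-unsnoc s x p
... | m , p₁ , p₂ = m , stepDown a p₁ , p₂

stripPath-snoc : ∀ {h y m e} s x → StripPath h y s m → StripPath h m (x ∷ []) e → StripPath h y (s ∷ʳ x) e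
stripPath-snoc []           x done           q = q
stripPath-snoc (up ∷ s)     x (stepUp a p)   q = stepUp a (stripPath-snoc s x p q)
stripPath-snoc (down k ∷ s) x (stepDown a p) q = stepDown a (stripPath-snoc s x p q)

length-∷ʳ : ∀ (s : List Step) x → length (s ∷ʳ x) ≡ suc (length s)
length-∷ʳ s x = trans (LP.length-++ s) (ℕP.+-comm (length s) 1)

-- The two ways a path of length n+1 ending at level e can end: an up-step
-- from level e-1, or a down-step by t+1 from level e+1+t with t < h-e.
EndsUp : ℕ → ℕ → ℕ → Set
EndsUp h n zero    = ⊥
EndsUp h n (suc e) = DeutschStrip h e n

EndsDown : ℕ → ℕ → ℕ → Set
EndsDown h n e = Σ (Fin (h ∸ e)) (λ t → DeutschStrip h (suc e ℕ.+ toℕ t) n)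

LastStep : ℕ → ℕ → ℕ → Set
LastStep h n e = EndsUp h n e ⊎ EndsDown h n e

stepsOf : ∀ {h n} e → LastStep h n e → List Step
stepsOf e       (inj₂ (t , w)) = proj₁ w ∷ʳ down (toℕ t)
stepsOf (suc e) (inj₁ w)       = proj₁ w ∷ʳ up

down-injective : ∀ {k k′} → down k ≡ down k′ → k ≡ k′
down-injective refl = refl

stepsOf-injective : ∀ {h n} e (x y : LastStep h n e) → stepsOf e x ≡ stepsOf e y → x ≡ y
stepsOf-injective e (inj₂ (t , w)) (inj₂ (t′ , w′)) eq
  with refl ← FP.toℕ-injective (down-injective (LP.∷ʳ-injectiveʳ (proj₁ w) (proj₁ w′) eq))
  = cong (λ w → inj₂ (t , w)) (deutschStrip-≡ w w′ (LP.∷ʳ-injectiveˡ (proj₁ w) (proj₁ w′) eq))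
stepsOf-injective (suc e) (inj₁ w) (inj₁ w′) eq =
  cong inj₁ (deutschStrip-≡ w w′ (LP.∷ʳ-injectiveˡ (proj₁ w) (proj₁ w′) eq))
stepsOf-injective (suc e) (inj₁ w) (inj₂ (t , w′)) eq with () ← LP.∷ʳ-injectiveʳ (proj₁ w) (proj₁ w′) eq
stepsOf-injective (suc e) (inj₂ (t , w)) (inj₁ w′) eq with () ← LP.∷ʳ-injectiveʳ (proj₁ w) (proj₁ w′) eq

extend : ∀ {h n} e → e ≤ h → LastStep h n e → DeutschStrip h e (suc n)
extend {h} e _ (inj₂ (t , (s , len , p))) =
  s ∷ʳ down (toℕ t) , trans (length-∷ʳ s _) (cong suc len) ,
  stripPath-snoc s _ p (stepDown (s≤s (ℕP.m≤n+m (toℕ t) e))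
    (subst (λ y → StripPath h y [] e) (sym (ℕP.m+n∸n≡m e (toℕ t))) done))
extend (suc e) e+1≤h (inj₁ (s , len , p)) =
  s ∷ʳ up , trans (length-∷ʳ s up) (cong suc len) , stripPath-snoc s up p (stepUp e+1≤h done)

extend-steps : ∀ {h n} e e≤h (x : LastStep h n e) → proj₁ (extend e e≤h x) ≡ stepsOf e x
extend-steps e       _ (inj₂ _) = refl
extend-steps (suc e) _ (inj₁ _) = refl

-- Recognising the last step of a path; a down-step by k+1 into level e starts
-- at level e+1+k ≤ h.
classifyLast : ∀ {h n m e} s x → length s ≡ n → StripPath h 0 s m → StripPath h m (x ∷ []) e →
  Σ (LastStep h n e) (λ y → stepsOf e y ≡ s ∷ʳ x)
classifyLast s up len p (stepUp _ done) = inj₁ (s , len , p) , refl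
classifyLast {h} {n} {m} s (down k) len p (stepDown k+1≤m done) =
  inj₂ (t , s , len , subst (StripPath h 0 s) m≡source p) ,
  cong (λ j → s ∷ʳ down j) (FP.toℕ-fromℕ< k<h-e)
  where
  k<h-e : k < h ∸ (m ∸ suc k)
  k<h-e = ℕP.≤-trans (ℕP.≤-reflexive (sym (ℕP.m∸[m∸n]≡n k+1≤m)))
                     (ℕP.∸-monoˡ-≤ (m ∸ suc k) (stripPath-bound p z≤n))
  t = fromℕ< k<h-e
  m≡source : m ≡ suc (m ∸ suc k) ℕ.+ toℕ t
  m≡source = trans (sym (ℕP.m∸n+n≡m k+1≤m))
    (trans (ℕP.+-suc (m ∸ suc k) k) (cong (λ j → suc ((m ∸ suc k) ℕ.+ j)) (sym (FP.toℕ-fromℕ< k<h-e))))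

splitLast : ∀ {h n e} → e ≤ h → (w : DeutschStrip h e (suc n)) → Σ (LastStep h n e) (λ y → stepsOf e y ≡ proj₁ w)
splitLast _ (s , len , p) with initLast s
splitLast _ (.[] , () , p) | []
splitLast _ (.(s ∷ʳ x) , len , p) | s ∷ʳ′ x with stripPath-unsnoc s x p
... | m , p₁ , p₂ = classifyLast s x (ℕP.suc-injective (trans (sym (length-∷ʳ s x)) len)) p₁ p₂

lastStep↔ : ∀ {h n} e → e ≤ h → DeutschStrip h e (suc n) ↔ LastStep h n e
lastStep↔ e e≤h = mk↔ₛ′ (λ w → proj₁ (splitLast e≤h w)) (extend e e≤h)
  (λ y → stepsOf-injective e _ y (trans (proj₂ (splitLast e≤h (extend e e≤h y))) (extend-steps e e≤h y)))
  (λ w → deutschStrip-≡ _ w (trans (extend-steps e e≤h (proj₁ (splitLast e≤h w))) (proj₂ (splitLast e≤h w))))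

Fin-sumN↔Σ : ∀ k (c : ℕ → ℕ) (A : Fin k → Set) → (∀ t → Fin (c (toℕ t)) ↔ A t) →
  Fin (sumN c k) ↔ Σ (Fin k) A
Fin-sumN↔Σ zero    c A _ = mk↔ₛ′ (λ ()) (λ { (() , _) }) (λ { (() , _) }) (λ ())
Fin-sumN↔Σ (suc k) c A fibres =
  ↔-trans FP.+↔⊎
    (↔-trans (fibres Fin.zero ⊎-↔ Fin-sumN↔Σ k (λ t → c (suc t)) (λ t → A (Fin.suc t)) (λ t → fibres (Fin.suc t)))
             (mk↔ₛ′ join split (λ { (Fin.zero , _) → refl ; (Fin.suc _ , _) → refl })
                               (λ { (inj₁ _) → refl ; (inj₂ _) → refl })))
  where
  join : A Fin.zero ⊎ Σ (Fin k) (λ t → A (Fin.suc t)) → Σ (Fin (suc k)) A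
  join (inj₁ a)       = Fin.zero , a
  join (inj₂ (t , a)) = Fin.suc t , a
  split : Σ (Fin (suc k)) A → A Fin.zero ⊎ Σ (Fin k) (λ t → A (Fin.suc t))
  split (Fin.zero  , a) = inj₁ a
  split (Fin.suc t , a) = inj₂ (t , a)

countIso : ∀ h n e → e ≤ h → Fin (count h n e) ↔ DeutschStrip h e n
countIso h zero zero _ =
  mk↔ₛ′ (λ _ → [] , refl , done) (λ _ → Fin.zero) (λ { ([] , refl , done) → refl }) (λ { Fin.zero → refl ; (Fin.suc ()) })
countIso h zero (suc e) _ =
  mk↔ₛ′ (λ ()) (λ { ([] , refl , ()) }) (λ { ([] , refl , ()) }) (λ ())
countIso h (suc n) e e≤h =
  ↔-trans FP.+↔⊎ (↔-trans (endsUp e e≤h ⊎-↔ endsDown) (↔-sym (lastStep↔ e e≤h)))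
  where
  endsUp : ∀ e → e ≤ h → Fin (belowN (count h n) e) ↔ EndsUp h n e
  endsUp zero    _     = mk↔ₛ′ (λ ()) (λ ()) (λ ()) (λ ())
  endsUp (suc e) e+1≤h = countIso h n e (ℕP.<⇒≤ e+1≤h)
  endsDown : Fin (sumN (λ t → count h n (suc e ℕ.+ t)) (h ∸ e)) ↔ EndsDown h n e
  endsDown = Fin-sumN↔Σ (h ∸ e) (λ t → count h n (suc e ℕ.+ t)) _
    (λ t → countIso h n (suc e ℕ.+ toℕ t) (above-bound e≤h (FP.toℕ<n t)))

mainTheorem1 : (h i : ℕ) → i ≤ h → (n : ℕ) →
    Σ ℕ (λ a → (Fin a ↔ DeutschStrip h i n) × rhsP h i n ≡ + a)
mainTheorem1 h i i≤h n = count h n i , countIso h n i i≤h , rhsP-coeff h n i i≤h
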